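{- Let $q$ be a prime power and $n$ a positive even integer. Let $\Omega_{q,n}$ be the set of all distinct double Toeplitz $[n,n/2]$ codes over $\mathbb{F}_q$, and let $\Psi_{q,n}(y)=\sum_{C\in\Omega_{q,n}} W_C(y)$. Then \[ \Psi_{q,n}(y)=q^{n-1}+q^{\frac{n}{2}-1}\left(\sum_{j=1}^{n/2}\left(\binom{n}{j}-\binom{n/2}{j}\right)(q-1)^j y^j+\sum_{j=n/2+1}^{n}\binom{n}{j}(q-1)^j y^j\right). \]
   Context: For $m\ge1$, $t\in\mathbb{F}_q$, $a=(a_1,\dots,a_{m-1})$, $b=(b_1,\dots,b_{m-1})\in\mathbb{F}_q^{m-1}$, the Toeplitz matrix $T(t,a,b)$ is the $m\times m$ matrix whose $(i,j)$ entry is $t$ if $i=j$, $a_{j-i}$ if $j>i$, and $b_{i-j}$ if $i>j$. The double Toeplitz code $\mathcal{T}(t,a,b)$ is the linear $[2m,m]$ code over $\mathbb{F}_q$ with generator matrix $(I_m\mid T(t,a,b))$; a double Toeplitz $[n,n/2]$ code is such a code with $m=n/2$, and "distinct" means distinct as subsets of $\mathbb{F}_q^n$. The weight enumerator of a code $C$ is $W_C(y)=\sum_{c\in C}y^{\mathrm{wt}(c)}$, where $\mathrm{wt}$ is Hamming weight. $\Psi_{q,n}$ is called the average weight enumerator of double Toeplitz $[n,n/2]$ codes. -}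

module Defs where

open import Level using (Level; suc; _⊔_)
open import Algebra.Bundles using (CommutativeRing)
open import Relation.Nullary using (¬_; Dec; yes; no)
open import Relation.Nullary.Decidable using (⌊_⌋)
open import Data.Bool using (Bool; true; false; _∧_; _∨_; not; if_then_else_)
open import Data.Nat as ℕ using (ℕ; zero; _∸_; _^_; _≤_; _<ᵇ_; _≡ᵇ_)
open import Data.Nat.Primality using (Prime)
open import Data.Product using (_×_; _,_; ∃-syntax)
open import Data.List as List using (List; []; _∷_; length; concatMap; map; filter; foldr)
open import Data.List.Relation.Unary.Any using (Any)
open import Data.List.Relation.Unary.AllPairs using (AllPairs)
open import Data.Vec as Vec using (Vec; []; _∷_; _++_; tabulate)
open import Data.Fin using (Fin; toℕ)
open import Data.Nat.Combinatorics using (_C_)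
import Relation.Nullary.Decidable.Core
import Data.Bool.ListAction as BL
import Data.Nat.ListAction as NL
open import Relation.Binary.PropositionalEquality using (_≡_)

IsPrimePower : ℕ → Set
IsPrimePower q = ∃[ p ] ∃[ k ] (Prime p × 1 ≤ k × q ≡ p ^ k)

record FiniteField (c ℓ : Level) : Set (Level.suc (c ⊔ ℓ)) where
  field
    commRing : CommutativeRing c ℓ
  open CommutativeRing commRing public
  field
    0≉1      : ¬ (0# ≈ 1#)
    inverse  : ∀ x → ¬ (x ≈ 0#) → ∃[ y ] (x * y ≈ 1#)
    _≟_      : ∀ x y → Dec (x ≈ y)
    elements : List Carrier
    complete : ∀ x → Any (x ≈_) elements
    distinct : AllPairs (λ x y → ¬ (x ≈ y)) elements

  order : ℕ
  order = length elements

module Coding {c ℓ} (F : FiniteField c ℓ) where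
  open FiniteField F

  _==_ : Carrier → Carrier → Bool
  x == y = ⌊ x ≟ y ⌋

  vecs : (k : ℕ) → List (Vec Carrier k)
  vecs zero = [] ∷ []
  vecs (ℕ.suc k) = concatMap (λ x → map (x ∷_) (vecs k)) elements

  eqVec : ∀ {k} → Vec Carrier k → Vec Carrier k → Bool
  eqVec [] [] = true
  eqVec (x ∷ xs) (y ∷ ys) = (x == y) ∧ eqVec xs ys

  wt : ∀ {k} → Vec Carrier k → ℕ
  wt [] = 0
  wt (x ∷ xs) = (if x == 0# then 0 else 1) ℕ.+ wt xs

  -- entry d (0-based) of a vector; only used in range
  idx : ∀ {k} → Vec Carrier k → ℕ → Carrier
  idx [] _ = 0#
  idx (x ∷ xs) zero = x
  idx (x ∷ xs) (ℕ.suc d) = idx xs d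

  -- parameters (t, a, b) of an m×m Toeplitz matrix, m = suc k;
  -- a = (a_1,…,a_{m-1}) and b = (b_1,…,b_{m-1}) stored 0-based
  Params : ℕ → Set c
  Params k = Carrier × Vec Carrier k × Vec Carrier k

  allParams : (k : ℕ) → List (Params k)
  allParams k = concatMap (λ t → concatMap (λ a → map (λ b → (t , a , b)) (vecs k)) (vecs k)) elements

  toeplitz : ∀ {k} → Params k → Fin (ℕ.suc k) → Fin (ℕ.suc k) → Carrier
  toeplitz (t , a , b) i j =
    if toℕ i ≡ᵇ toℕ j then t
    else if toℕ i <ᵇ toℕ j then idx a (toℕ j ∸ toℕ i ∸ 1)
    else idx b (toℕ i ∸ toℕ j ∸ 1)

  sumVec : ∀ {k} → Vec Carrier k → Carrier
  sumVec = Vec.foldr _ _+_ 0#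

  encode : ∀ {k} → Params k → Vec Carrier (ℕ.suc k) → Vec Carrier (ℕ.suc k ℕ.+ ℕ.suc k)
  encode p x = x ++ tabulate (λ j → sumVec (tabulate (λ i → Vec.lookup x i * toeplitz p i j)))

  -- membership of v ∈ F^n in the double Toeplitz code 𝒯(t,a,b)
  -- (the row space of (I | T(t,a,b)))
  inCode : ∀ {k} → Params k → Vec Carrier (ℕ.suc k ℕ.+ ℕ.suc k) → Bool
  inCode {k} p v = BL.any (λ x → eqVec (encode p x) v) (vecs (ℕ.suc k))

  sameCode : ∀ {k} → Params k → Params k → Bool
  sameCode {k} p p' = BL.all (λ v → not (inCode p v) ∨ inCode p' v)
                               (vecs (ℕ.suc k ℕ.+ ℕ.suc k))
                    ∧ BL.all (λ v → not (inCode p' v) ∨ inCode p v)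
                               (vecs (ℕ.suc k ℕ.+ ℕ.suc k))

  dedup : ∀ {k} → List (Params k) → List (Params k) → List (Params k)
  dedup seen [] = []
  dedup seen (p ∷ ps) =
    if BL.any (sameCode p) seen then dedup seen ps else p ∷ dedup (p ∷ seen) ps

  -- Ω_{q,n}, n = 2m, m = suc k: the distinct double Toeplitz [n, n/2] codes,
  -- each given by one of its parameter triples
  Ω : (k : ℕ) → List (Params k)
  Ω k = dedup [] (allParams k)

  -- number of codewords of weight j in 𝒯(p), i.e. coefficient of y^j in W_𝒯(p)(y)
  weightCount : ∀ {k} → Params k → ℕ → ℕ
  weightCount {k} p j =
    length (filter (λ v → Relation.Nullary.Decidable.Core.T? (inCode p v ∧ (wt v ≡ᵇ j)))
                   (vecs (ℕ.suc k ℕ.+ ℕ.suc k)))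

  -- coefficient of y^j in Ψ_{q,n}(y) = Σ_{C ∈ Ω} W_C(y)
  Ψcoeff : ℕ → ℕ → ℕ
  Ψcoeff k j = NL.sum (map (λ p → weightCount p j) (Ω k))

closedCoeff : (q m j : ℕ) → ℕ
closedCoeff q m zero = q ^ ((m ℕ.+ m) ∸ 1)
closedCoeff q m (ℕ.suc i) =
  if ℕ.suc i ℕ.≤ᵇ m
  then q ^ (m ∸ 1) ℕ.* (((m ℕ.+ m) C ℕ.suc i ∸ m C ℕ.suc i) ℕ.* (q ∸ 1) ^ ℕ.suc i)
  else q ^ (m ∸ 1) ℕ.* (((m ℕ.+ m) C ℕ.suc i) ℕ.* (q ∸ 1) ^ ℕ.suc i)

{-# OPTIONS --safe #-}
-- Two parameter triples never give the same code: the codeword of the unit message e₀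
-- (resp. e_{m-1}) carries row 0 (resp. row m-1) of T(t,a,b), and together these rows
-- contain t, a and b. Hence Ω is the whole parameter space F × F^{m-1} × F^{m-1}, and
-- Ψ_j counts the pairs (parameters, message x) whose codeword (x, xT) has weight j.
-- The zero message gives q^{2m-1} such pairs, all of weight 0. For x ≠ 0, xT(t,a,b) is
-- the vector of sliding dot products of x with the sequence (a_{m-1},…,a_1,t,b_1,…,b_{m-1}),
-- a linear map of the sequence onto F^m all of whose fibres have size q^{m-1}: a nonzero
-- coordinate of x lets each output coordinate be solved for a fresh term of the sequence.
-- So the nonzero messages contribute q^{m-1} (#{(x,y) : wt x + wt y = j} - #{y : wt y = j}),
-- and F^n has C(n,j)(q-1)^j words of weight j.
module Submission where

open import Defs
open import Level using (Level; _⊔_)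
open import Data.Nat using (ℕ; suc; _+_)
open import Relation.Binary.PropositionalEquality using (_≡_)

open import Data.Bool using (Bool; true; false; T; _∧_; if_then_else_)
open import Data.Bool.Properties using (T-∧; T-≡)
import Data.Bool.ListAction as BL
open import Data.Fin as Fin using (Fin; toℕ; opposite; fromℕ; fromℕ<)
open import Data.Fin.Properties
  using (toℕ≤pred[n]; toℕ-fromℕ; toℕ-fromℕ<; opposite-prop; opposite-involutive)
open import Data.List as List using (List; []; _∷_; concatMap; map; length; filter; drop)
open import Data.List.Properties using (drop-drop)
open import Data.List.Relation.Unary.All as All using (All; []; _∷_)
import Data.List.Relation.Unary.All.Properties as Allₚ
open import Data.List.Relation.Unary.Any as Any using (Any; here; there)
import Data.List.Relation.Unary.Any.Properties as Anyₚ
open import Data.List.Relation.Unary.AllPairs as AllPairs using (AllPairs; []; _∷_)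
import Data.List.Relation.Unary.AllPairs.Properties as AllPairsₚ
import Data.List.Relation.Binary.Pointwise as LPW
open import Data.Nat as ℕ
  using (zero; _*_; _∸_; _^_; _≤_; _<_; s≤s; z≤n; _≡ᵇ_; _<ᵇ_; _≤ᵇ_)
open import Data.Nat.Properties hiding (_≟_)
open import Algebra.Properties.CommutativeSemigroup +-commutativeSemigroup using (interchange)
open import Data.Nat.Combinatorics using (_C_; nCk+nC[k+1]≡[n+1]C[k+1]; k>n⇒nCk≡0)
open import Data.Nat.Tactic.RingSolver using (solve-∀)
import Data.Nat.ListAction as NL
open import Data.Product using (_×_; _,_; proj₁; proj₂)
open import Data.Vec as Vec using (Vec; []; _∷_; _++_; tabulate; lookup; toList)
open import Data.Vec.Properties using (lookup∘tabulate; tabulate∘lookup; tabulate-cong)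
import Data.Vec.Relation.Binary.Pointwise.Inductive as PW
import Data.Vec.Relation.Unary.Any as VecAny
open import Function using (_∘_)
open import Function.Bundles using (_⇔_; mk⇔; Equivalence)
open import Relation.Binary.Bundles using (DecSetoid)
open import Relation.Binary.Core using (Rel; _Preserves_⟶_)
open import Relation.Binary.Definitions using (tri<; tri≈; tri>)
open import Relation.Binary.PropositionalEquality
  using (refl; sym; trans; cong; cong₂; subst; subst₂; module ≡-Reasoning)
open import Relation.Nullary using (¬_; Dec; yes; no; contradiction)
open import Relation.Nullary.Decidable
  using (⌊_⌋; isYes≗does; does-⇔; toWitness; fromWitness)
open import Relation.Nullary.Decidable.Core using (T?)

open ≡-Reasoning

module _ {a} {A : Set a} where

  ∑ : List A → (A → ℕ) → ℕ
  ∑ []       f = 0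
  ∑ (x ∷ xs) f = f x + ∑ xs f

  syntax ∑ xs (λ x → e) = ∑[ x ∈ xs ] e

  ∑-cong : ∀ {f g : A → ℕ} → (∀ x → f x ≡ g x) → ∀ xs → ∑ xs f ≡ ∑ xs g
  ∑-cong f≗g []       = refl
  ∑-cong f≗g (x ∷ xs) = cong₂ _+_ (f≗g x) (∑-cong f≗g xs)

  ∑-++ : ∀ xs ys (f : A → ℕ) → ∑ (xs List.++ ys) f ≡ ∑ xs f + ∑ ys f
  ∑-++ []       ys f = refl
  ∑-++ (x ∷ xs) ys f = trans (cong (f x +_) (∑-++ xs ys f)) (sym (+-assoc (f x) _ _))

  ∑-distrib-+ : ∀ xs (f g : A → ℕ) → ∑[ x ∈ xs ] (f x + g x) ≡ ∑ xs f + ∑ xs g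
  ∑-distrib-+ []       f g = refl
  ∑-distrib-+ (x ∷ xs) f g =
    trans (cong (f x + g x +_) (∑-distrib-+ xs f g)) (interchange (f x) (g x) _ _)

  ∑-*ˡ : ∀ c xs (f : A → ℕ) → ∑[ x ∈ xs ] (c * f x) ≡ c * ∑ xs f
  ∑-*ˡ c []       f = sym (*-zeroʳ c)
  ∑-*ˡ c (x ∷ xs) f =
    trans (cong (c * f x +_) (∑-*ˡ c xs f)) (sym (*-distribˡ-+ c (f x) _))

  ∑-const : ∀ xs c → ∑[ _ ∈ xs ] c ≡ length xs * c
  ∑-const []       c = refl
  ∑-const (x ∷ xs) c = cong (c +_) (∑-const xs c)

  sum-map : ∀ (f : A → ℕ) xs → NL.sum (map f xs) ≡ ∑ xs f
  sum-map f []       = refl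
  sum-map f (x ∷ xs) = cong (f x +_) (sum-map f xs)

module _ {a b} {A : Set a} {B : Set b} where

  ∑-map : ∀ (h : B → A) ys (f : A → ℕ) → ∑ (map h ys) f ≡ ∑[ y ∈ ys ] f (h y)
  ∑-map h []       f = refl
  ∑-map h (y ∷ ys) f = cong (f (h y) +_) (∑-map h ys f)

  ∑-concatMap : ∀ (h : B → List A) ys (f : A → ℕ) →
                ∑ (concatMap h ys) f ≡ ∑[ y ∈ ys ] ∑ (h y) f
  ∑-concatMap h []       f = refl
  ∑-concatMap h (y ∷ ys) f =
    trans (∑-++ (h y) _ f) (cong (∑ (h y) f +_) (∑-concatMap h ys f))

  ∑-comm : ∀ xs ys (f : A → B → ℕ) →
           ∑[ x ∈ xs ] ∑[ y ∈ ys ] f x y ≡ ∑[ y ∈ ys ] ∑[ x ∈ xs ] f x y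
  ∑-comm []       ys f = sym (trans (∑-const ys 0) (*-zeroʳ (length ys)))
  ∑-comm (x ∷ xs) ys f =
    trans (cong (∑ ys (f x) +_) (∑-comm xs ys f)) (sym (∑-distrib-+ ys (f x) _))

𝟙 : Bool → ℕ
𝟙 true  = 1
𝟙 false = 0

length-filter : ∀ {a} {A : Set a} (p : A → Bool) xs →
                length (filter (λ x → T? (p x)) xs) ≡ ∑[ x ∈ xs ] 𝟙 (p x)
length-filter p []       = refl
length-filter p (x ∷ xs) with p x
... | true  = cong suc (length-filter p xs)
... | false = length-filter p xs

⌊⌋-⇔ : ∀ {p q} {P : Set p} {Q : Set q} → P ⇔ Q → (p? : Dec P) (q? : Dec Q) →
       ⌊ p? ⌋ ≡ ⌊ q? ⌋
⌊⌋-⇔ P⇔Q p? q? =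
  trans (isYes≗does p?) (trans (does-⇔ P⇔Q p? q?) (sym (isYes≗does q?)))

T⇔-⌊⌋ : ∀ {p} {P : Set p} b → T b ⇔ P → (P? : Dec P) → b ≡ ⌊ P? ⌋
T⇔-⌊⌋ true  b⇔P P? = ⌊⌋-⇔ b⇔P (T? true) P?
T⇔-⌊⌋ false b⇔P P? = ⌊⌋-⇔ b⇔P (T? false) P?

¬T⇒≡false : ∀ {b} → ¬ T b → b ≡ false
¬T⇒≡false {true}  ¬t = contradiction _ ¬t
¬T⇒≡false {false} _  = refl

if-true : ∀ {a} {A : Set a} {b} {x y : A} → T b → (if b then x else y) ≡ x
if-true {b = true} _ = refl

if-false : ∀ {a} {A : Set a} {b} {x y : A} → ¬ T b → (if b then x else y) ≡ y
if-false ¬b rewrite ¬T⇒≡false ¬b = refl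

any-false : ∀ {a} {A : Set a} (f : A → Bool) {xs} →
            All (λ x → f x ≡ false) xs → BL.any f xs ≡ false
any-false f []       = refl
any-false f (e ∷ es) rewrite e = any-false f es

module _ {a b r s} {A : Set a} {B : Set b} {R : Rel A r} {S : Rel B s} where

  allPairs-concatMap⁺ : (h : A → List B) (tag : B → A) →
    (∀ x → All (λ z → tag z ≡ x) (h x)) → (∀ {z w} → R (tag z) (tag w) → S z w) →
    (∀ x → AllPairs S (h x)) → ∀ {xs} → AllPairs R xs → AllPairs S (concatMap h xs)
  allPairs-concatMap⁺ h tag tagged separate inner {xs} outer =
    AllPairsₚ.concat⁺ (Allₚ.map⁺ (All.universal inner xs))
                      (AllPairsₚ.map⁺ (AllPairs.map across outer))
    where
    across : ∀ {x y} → R x y → All (λ z → All (S z) (h y)) (h x)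
    across {x} {y} Rxy = All.map (λ tz≡x → All.map (λ tw≡y →
      separate (subst₂ R (sym tz≡x) (sym tw≡y) Rxy)) (tagged y)) (tagged x)

-- A list meeting every ≈-class exactly once: sums over it are sums over the finite
-- quotient, so they can be reindexed along maps that are only invertible up to ≈.
record Enumeration {a ℓ} (S : DecSetoid a ℓ) : Set (a ⊔ ℓ) where
  open DecSetoid S using (Carrier; _≈_; _≟_) renaming (sym to ≈-sym; trans to ≈-trans)
  field
    list     : List Carrier
    complete : ∀ x → Any (x ≈_) list
    distinct : AllPairs (λ x y → ¬ x ≈ y) list

  δ δᶜ : Carrier → Carrier → ℕ → ℕ
  δ  z x n = if ⌊ z ≟ x ⌋ then n else 0
  δᶜ z x n = if ⌊ z ≟ x ⌋ then 0 else n

  ∑-δ : ∀ z (h : Carrier → ℕ) → h Preserves _≈_ ⟶ _≡_ →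
        ∑[ x ∈ list ] δ z x (h x) ≡ h z
  ∑-δ z h h-resp = go (complete z) distinct
    where
    vanish : ∀ {x} ys → z ≈ x → All (λ y → ¬ x ≈ y) ys → ∑[ y ∈ ys ] δ z y (h y) ≡ 0
    vanish []       _   []            = refl
    vanish (y ∷ ys) z≈x (x≉y ∷ x≉ys) with z ≟ y
    ... | yes z≈y = contradiction (≈-trans (≈-sym z≈x) z≈y) x≉y
    ... | no  _   = vanish ys z≈x x≉ys
    go : ∀ {ys} → Any (z ≈_) ys → AllPairs (λ x y → ¬ x ≈ y) ys →
         ∑[ y ∈ ys ] δ z y (h y) ≡ h z
    go {x ∷ ys} z∈ (x≉ys ∷ _) with z ≟ x
    go {x ∷ ys} _          (x≉ys ∷ _) | yes z≈x =
      trans (cong₂ _+_ (sym (h-resp z≈x)) (vanish ys z≈x x≉ys)) (+-identityʳ (h z))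
    go {x ∷ ys} (here z≈x) _          | no  z≉x = contradiction z≈x z≉x
    go {x ∷ ys} (there z∈) (_ ∷ d)    | no  _   = go z∈ d

  ∑-split : ∀ z (h : Carrier → ℕ) → h Preserves _≈_ ⟶ _≡_ →
            ∑ list h ≡ h z + ∑[ x ∈ list ] δᶜ z x (h x)
  ∑-split z h h-resp = begin
    ∑ list h
      ≡⟨ ∑-cong δ+δᶜ list ⟩
    ∑[ x ∈ list ] (δ z x (h x) + δᶜ z x (h x))
      ≡⟨ ∑-distrib-+ list _ _ ⟩
    ∑[ x ∈ list ] δ z x (h x) + ∑[ x ∈ list ] δᶜ z x (h x)
      ≡⟨ cong (_+ ∑[ x ∈ list ] δᶜ z x (h x)) (∑-δ z h h-resp) ⟩
    h z + ∑[ x ∈ list ] δᶜ z x (h x) ∎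
    where
    δ+δᶜ : ∀ x → h x ≡ δ z x (h x) + δᶜ z x (h x)
    δ+δᶜ x with z ≟ x
    ... | yes _ = sym (+-identityʳ (h x))
    ... | no  _ = refl

  ∑-δᶜ : ∀ z (h : Carrier → ℕ) → h Preserves _≈_ ⟶ _≡_ →
         ∑[ x ∈ list ] δᶜ z x (h x) ≡ ∑ list h ∸ h z
  ∑-δᶜ z h h-resp = sym (trans (cong (_∸ h z) (∑-split z h h-resp)) (m+n∸m≡n (h z) _))

  ∑-δᶜ-cong : ∀ z {f g : Carrier → ℕ} → (∀ x → ¬ z ≈ x → f x ≡ g x) →
              ∑[ x ∈ list ] δᶜ z x (f x) ≡ ∑[ x ∈ list ] δᶜ z x (g x)
  ∑-δᶜ-cong z f≗g = ∑-cong off-z list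
    where
    off-z : ∀ x → δᶜ z x _ ≡ δᶜ z x _
    off-z x with z ≟ x
    ... | yes _   = refl
    ... | no  z≉x = f≗g x z≉x

  ∑-reindex : (f g : Carrier → Carrier) → (∀ {x y} → f x ≈ y ⇔ g y ≈ x) →
              (h : Carrier → ℕ) → h Preserves _≈_ ⟶ _≡_ →
              ∑[ x ∈ list ] h (f x) ≡ ∑ list h
  ∑-reindex f g inverse h h-resp = begin
    ∑[ x ∈ list ] h (f x)
      ≡⟨ ∑-cong (λ x → sym (∑-δ (f x) h h-resp)) list ⟩
    ∑[ x ∈ list ] ∑[ y ∈ list ] δ (f x) y (h y)
      ≡⟨ ∑-comm list list _ ⟩
    ∑[ y ∈ list ] ∑[ x ∈ list ] δ (f x) y (h y)
      ≡⟨ ∑-cong (λ y → ∑-cong (swap y) list) list ⟩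
    ∑[ y ∈ list ] ∑[ x ∈ list ] δ (g y) x (h y)
      ≡⟨ ∑-cong (λ y → ∑-δ (g y) (λ _ → h y) (λ _ → refl)) list ⟩
    ∑ list h ∎
    where
    swap : ∀ y x → δ (f x) y (h y) ≡ δ (g y) x (h y)
    swap y x = cong (if_then h y else 0) (⌊⌋-⇔ inverse (f x ≟ y) (g y ≟ x))

∸-suc : ∀ m n → m ∸ n ∸ 1 ≡ m ∸ suc n
∸-suc m n = trans (∸-+-assoc m n 1) (cong (m ∸_) (+-comm n 1))

k∸j+i<k : ∀ {i j k} → j ≤ k → i < j → k ∸ j + i < k
k∸j+i<k {i} {j} {k} j≤k i<j =
  subst (k ∸ j + i <_) (m∸n+n≡m j≤k) (+-monoʳ-< (k ∸ j) i<j)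

k∸[1+k∸j+i]≡j∸i∸1 : ∀ {i j k} → j ≤ k → k ∸ suc (k ∸ j + i) ≡ j ∸ i ∸ 1
k∸[1+k∸j+i]≡j∸i∸1 {i} {j} {k} j≤k = begin
  k ∸ suc (k ∸ j + i)  ≡⟨ cong (k ∸_) (sym (+-suc (k ∸ j) i)) ⟩
  k ∸ (k ∸ j + suc i)  ≡⟨ sym (∸-+-assoc k (k ∸ j) (suc i)) ⟩
  k ∸ (k ∸ j) ∸ suc i  ≡⟨ cong (_∸ suc i) (m∸[m∸n]≡n j≤k) ⟩
  j ∸ suc i            ≡⟨ sym (∸-suc j i) ⟩
  j ∸ i ∸ 1            ∎

k∸j+i≡k+suc[i∸j∸1] : ∀ {i j k} → j ≤ k → j < i → k ∸ j + i ≡ k + suc (i ∸ j ∸ 1)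
k∸j+i≡k+suc[i∸j∸1] {i} {j} {k} j≤k j<i = begin
  k ∸ j + i            ≡⟨ sym (+-∸-comm i j≤k) ⟩
  k + i ∸ j            ≡⟨ +-∸-assoc k (<⇒≤ j<i) ⟩
  k + (i ∸ j)          ≡⟨ cong (k +_) (+-∸-assoc 1 j<i) ⟩
  k + suc (i ∸ suc j)  ≡⟨ cong (λ d → k + suc d) (sym (∸-suc i j)) ⟩
  k + suc (i ∸ j ∸ 1)  ∎

rev : ∀ {a} {A : Set a} {n} → Vec A n → Vec A n
rev v = tabulate (λ i → lookup v (opposite i))

rev-involutive : ∀ {a} {A : Set a} {n} (v : Vec A n) → rev (rev v) ≡ v
rev-involutive v = trans (tabulate-cong (λ i →
  trans (lookup∘tabulate _ (opposite i)) (cong (lookup v) (opposite-involutive i))))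
  (tabulate∘lookup v)

-- The zero message accounts for the first term (all q^{2m-1} parameter triples give it
-- weight 0); each nonzero message x accounts for q^{m-1} · #{y : wt x + wt y = j}.
splitCoeff : (q k j a b : ℕ) → ℕ
splitCoeff q k j a b = q ^ (k + suc k) * 𝟙 (0 ≡ᵇ j) + q ^ k * (a ∸ b)

closedCoeff≡ : ∀ q k j →
  splitCoeff q k j (((suc k + suc k) C j) * (q ∸ 1) ^ j) ((suc k C j) * (q ∸ 1) ^ j)
  ≡ closedCoeff q (suc k) j
closedCoeff≡ q k zero =
  trans (cong₂ _+_ (*-identityʳ (q ^ (k + suc k))) (*-zeroʳ (q ^ k))) (+-identityʳ _)
closedCoeff≡ q k (suc i) = by-size (suc i ≤? suc k)
  where
  A = (suc k + suc k) C suc i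
  B = suc k C suc i
  r = (q ∸ 1) ^ suc i
  by-size : Dec (suc i ≤ suc k) →
            q ^ (k + suc k) * 0 + q ^ k * (A * r ∸ B * r) ≡ closedCoeff q (suc k) (suc i)
  by-size (yes i<m) = begin
    q ^ (k + suc k) * 0 + q ^ k * (A * r ∸ B * r)
      ≡⟨ cong (_+ q ^ k * (A * r ∸ B * r)) (*-zeroʳ (q ^ (k + suc k))) ⟩
    q ^ k * (A * r ∸ B * r)
      ≡⟨ cong (q ^ k *_) (sym (*-distribʳ-∸ r A B)) ⟩
    q ^ k * ((A ∸ B) * r)
      ≡⟨ sym (if-true {b = suc i ≤ᵇ suc k} (≤⇒≤ᵇ i<m)) ⟩
    closedCoeff q (suc k) (suc i) ∎
  by-size (no i≮m) = begin
    q ^ (k + suc k) * 0 + q ^ k * (A * r ∸ B * r)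
      ≡⟨ cong₂ (λ z b → z + q ^ k * (A * r ∸ b * r)) (*-zeroʳ (q ^ (k + suc k)))
                                                     (k>n⇒nCk≡0 (≰⇒> i≮m)) ⟩
    q ^ k * (A * r)
      ≡⟨ sym (if-false {b = suc i ≤ᵇ suc k} (i≮m ∘ ≤ᵇ⇒≤ (suc i) (suc k))) ⟩
    closedCoeff q (suc k) (suc i) ∎

module _ {c ℓ} (F : FiniteField c ℓ) where
  open Coding F
  open FiniteField F
    using (Carrier; _≈_; _≟_; 0#; 1#; elements)
    renaming (_+_ to _⊕_; _*_ to _⊗_; -_ to ⊖_;
              refl to ≈-refl; sym to ≈-sym; trans to ≈-trans; reflexive to ≈-reflexive)
  module F = FiniteField F

  q : ℕ
  q = F.order

  Fₛ : DecSetoid c ℓ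
  Fₛ = record
    { Carrier = Carrier ; _≈_ = _≈_
    ; isDecEquivalence = record { isEquivalence = F.isEquivalence ; _≟_ = _≟_ } }

  Vecₛ : ℕ → DecSetoid c (c ⊔ ℓ)
  Vecₛ = PW.decSetoid Fₛ

  module V {n} = DecSetoid (Vecₛ n)

  _≋_ : ∀ {n} → Vec Carrier n → Vec Carrier n → Set (c ⊔ ℓ)
  _≋_ = PW.Pointwise _≈_

  infix 4 _≋_

  vecs-complete : ∀ n (v : Vec Carrier n) → Any (v ≋_) (vecs n)
  vecs-complete zero    []      = here PW.[]
  vecs-complete (suc n) (x ∷ v) = Anyₚ.concatMap⁺ (λ y → map (y ∷_) (vecs n))
    (Any.map (λ x≈y → Anyₚ.map⁺ (Any.map (x≈y PW.∷_) (vecs-complete n v))) (F.complete x))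

  vecs-distinct : ∀ n → AllPairs (λ v w → ¬ v ≋ w) (vecs n)
  vecs-distinct zero    = [] ∷ []
  vecs-distinct (suc n) = allPairs-concatMap⁺ (λ x → map (x ∷_) (vecs n)) Vec.head
    (λ x → Allₚ.map⁺ (All.universal (λ _ → refl) (vecs n)))
    (λ { {_ ∷ _} {_ ∷ _} x≉y xv≋yw → x≉y (PW.head xv≋yw) })
    (λ x → AllPairsₚ.map⁺
      (AllPairs.map (λ v≉w xv≋xw → v≉w (PW.tail xv≋xw)) (vecs-distinct n)))
    F.distinct

  elementsEnum : Enumeration Fₛ
  elementsEnum = record { list = elements ; complete = F.complete ; distinct = F.distinct }

  vecsEnum : ∀ n → Enumeration (Vecₛ n)
  vecsEnum n = record { list = vecs n ; complete = vecs-complete n ; distinct = vecs-distinct n }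

  module Fᴱ = Enumeration elementsEnum
  module Vᴱ {n} = Enumeration (vecsEnum n)

  ∑-vecs-suc : ∀ n (G : Vec Carrier (suc n) → ℕ) →
               ∑ (vecs (suc n)) G ≡ ∑[ x ∈ elements ] ∑[ v ∈ vecs n ] G (x ∷ v)
  ∑-vecs-suc n G =
    trans (∑-concatMap _ elements G) (∑-cong (λ x → ∑-map (x ∷_) (vecs n) G) elements)

  ∑-vecs-++ : ∀ m n (G : Vec Carrier (m + n) → ℕ) →
              ∑ (vecs (m + n)) G ≡ ∑[ u ∈ vecs m ] ∑[ v ∈ vecs n ] G (u ++ v)
  ∑-vecs-++ zero    n G = sym (+-identityʳ _)
  ∑-vecs-++ (suc m) n G = begin
    ∑ (vecs (suc m + n)) G
      ≡⟨ ∑-vecs-suc (m + n) G ⟩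
    ∑[ x ∈ elements ] ∑[ w ∈ vecs (m + n) ] G (x ∷ w)
      ≡⟨ ∑-cong (λ x → ∑-vecs-++ m n (G ∘ (x ∷_))) elements ⟩
    ∑[ x ∈ elements ] ∑[ u ∈ vecs m ] ∑[ v ∈ vecs n ] G (x ∷ u ++ v)
      ≡⟨ sym (∑-vecs-suc m (λ u → ∑[ v ∈ vecs n ] G (u ++ v))) ⟩
    ∑[ u ∈ vecs (suc m) ] ∑[ v ∈ vecs n ] G (u ++ v) ∎

  ∑-vecs-const : ∀ n a → ∑[ _ ∈ vecs n ] a ≡ q ^ n * a
  ∑-vecs-const zero    a = refl
  ∑-vecs-const (suc n) a = begin
    ∑[ _ ∈ vecs (suc n) ] a
      ≡⟨ ∑-vecs-suc n (λ _ → a) ⟩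
    ∑[ _ ∈ elements ] ∑[ _ ∈ vecs n ] a
      ≡⟨ ∑-cong (λ _ → ∑-vecs-const n a) elements ⟩
    ∑[ _ ∈ elements ] (q ^ n * a)
      ≡⟨ ∑-const elements _ ⟩
    q * (q ^ n * a)
      ≡⟨ sym (*-assoc q _ a) ⟩
    q ^ suc n * a ∎

  ∑-params : ∀ k (h : Params k → ℕ) →
    ∑ (allParams k) h ≡
    ∑[ t ∈ elements ] ∑[ a ∈ vecs k ] ∑[ b ∈ vecs k ] h (t , a , b)
  ∑-params k h = trans (∑-concatMap _ elements h) (∑-cong (λ t →
    trans (∑-concatMap _ (vecs k) h) (∑-cong (λ a → ∑-map _ (vecs k) h) (vecs k)))
    elements)

  ∑-params-const : ∀ k a → ∑[ _ ∈ allParams k ] a ≡ q ^ (k + suc k) * a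
  ∑-params-const k a = begin
    ∑[ _ ∈ allParams k ] a
      ≡⟨ ∑-params k (λ _ → a) ⟩
    ∑[ _ ∈ elements ] ∑[ _ ∈ vecs k ] ∑[ _ ∈ vecs k ] a
      ≡⟨ ∑-cong (λ _ → trans (∑-cong (λ _ → ∑-vecs-const k a) (vecs k)) (∑-vecs-const k _))
                elements ⟩
    ∑[ _ ∈ elements ] (q ^ k * (q ^ k * a))
      ≡⟨ ∑-const elements _ ⟩
    q * (q ^ k * (q ^ k * a))
      ≡⟨ rearrange q (q ^ k) a ⟩
    q ^ k * q ^ suc k * a
      ≡⟨ cong (_* a) (sym (^-distribˡ-+-* q k (suc k))) ⟩
    q ^ (k + suc k) * a ∎
    where
    rearrange : ∀ q Q a → q * (Q * (Q * a)) ≡ Q * (q * Q) * a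
    rearrange = solve-∀

  zeros : ∀ n → Vec Carrier n
  zeros n = tabulate (λ _ → 0#)

  wt₁ : Carrier → ℕ
  wt₁ x = if x == 0# then 0 else 1

  wt₁-0# : wt₁ 0# ≡ 0
  wt₁-0# = if-true {b = 0# == 0#} (fromWitness ≈-refl)

  wt₁-≉0# : ∀ {x} → ¬ x ≈ 0# → wt₁ x ≡ 1
  wt₁-≉0# {x} x≉0 = if-false {b = x == 0#} (x≉0 ∘ toWitness)

  wt₁-cong : ∀ {x y} → x ≈ y → wt₁ x ≡ wt₁ y
  wt₁-cong {x} {y} x≈y = cong (if_then 0 else 1)
    (⌊⌋-⇔ (mk⇔ (≈-trans (≈-sym x≈y)) (≈-trans x≈y)) (x ≟ 0#) (y ≟ 0#))

  wt-cong : ∀ {n} {v w : Vec Carrier n} → v ≋ w → wt v ≡ wt w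
  wt-cong PW.[]          = refl
  wt-cong (x≈y PW.∷ v≋w) = cong₂ _+_ (wt₁-cong x≈y) (wt-cong v≋w)

  wt-++ : ∀ {m n} (v : Vec Carrier m) (w : Vec Carrier n) → wt (v ++ w) ≡ wt v + wt w
  wt-++ []      w = refl
  wt-++ (x ∷ v) w = trans (cong (wt₁ x +_) (wt-++ v w)) (sym (+-assoc (wt₁ x) (wt v) (wt w)))

  wt-zeros : ∀ n → wt (zeros n) ≡ 0
  wt-zeros zero    = refl
  wt-zeros (suc n) = cong₂ _+_ wt₁-0# (wt-zeros n)

  #weight : ℕ → ℕ → ℕ
  #weight n j = ∑[ v ∈ vecs n ] 𝟙 (wt v ≡ᵇ j)

  ∑-nonzero-const : ∀ M → ∑[ x ∈ elements ] Fᴱ.δᶜ 0# x M ≡ (q ∸ 1) * M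
  ∑-nonzero-const M = begin
    ∑[ x ∈ elements ] Fᴱ.δᶜ 0# x M  ≡⟨ Fᴱ.∑-δᶜ 0# (λ _ → M) (λ _ → refl) ⟩
    ∑[ _ ∈ elements ] M ∸ M        ≡⟨ cong (_∸ M) (∑-const elements M) ⟩
    q * M ∸ M                      ≡⟨ cong (q * M ∸_) (sym (*-identityˡ M)) ⟩
    q * M ∸ 1 * M                  ≡⟨ sym (*-distribʳ-∸ M q 1) ⟩
    (q ∸ 1) * M                    ∎

  #weight-suc : ∀ n j →
    #weight (suc n) j ≡ #weight n j + (q ∸ 1) * ∑[ v ∈ vecs n ] 𝟙 (suc (wt v) ≡ᵇ j)
  #weight-suc n j = begin
    #weight (suc n) j
      ≡⟨ ∑-vecs-suc n _ ⟩
    ∑ elements count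
      ≡⟨ Fᴱ.∑-split 0# count count-resp ⟩
    count 0# + ∑[ x ∈ elements ] Fᴱ.δᶜ 0# x (count x)
      ≡⟨ cong₂ _+_ count-0# (Fᴱ.∑-δᶜ-cong 0# count-≉0#) ⟩
    #weight n j + ∑[ x ∈ elements ] Fᴱ.δᶜ 0# x M
      ≡⟨ cong (#weight n j +_) (∑-nonzero-const M) ⟩
    #weight n j + (q ∸ 1) * M ∎
    where
    count : Carrier → ℕ
    count x = ∑[ v ∈ vecs n ] 𝟙 (wt₁ x + wt v ≡ᵇ j)
    M = ∑[ v ∈ vecs n ] 𝟙 (suc (wt v) ≡ᵇ j)
    count-with : ∀ {x y} → wt₁ x ≡ y → count x ≡ ∑[ v ∈ vecs n ] 𝟙 (y + wt v ≡ᵇ j)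
    count-with x≡y = ∑-cong (λ v → cong (λ w → 𝟙 (w + wt v ≡ᵇ j)) x≡y) (vecs n)
    count-resp : count Preserves _≈_ ⟶ _≡_
    count-resp x≈y = count-with (wt₁-cong x≈y)
    count-0# : count 0# ≡ #weight n j
    count-0# = count-with wt₁-0#
    count-≉0# : ∀ x → ¬ 0# ≈ x → count x ≡ M
    count-≉0# x 0≉x = count-with (wt₁-≉0# (0≉x ∘ ≈-sym))

  #weight≡ : ∀ n j → #weight n j ≡ (n C j) * (q ∸ 1) ^ j
  #weight≡ zero    zero    = refl
  #weight≡ zero    (suc j) = refl
  #weight≡ (suc n) zero    = begin
    #weight (suc n) 0
      ≡⟨ #weight-suc n 0 ⟩
    #weight n 0 + (q ∸ 1) * ∑[ _ ∈ vecs n ] 0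
      ≡⟨ cong₂ (λ w s → w + (q ∸ 1) * s) (#weight≡ n 0) (∑-vecs-const n 0) ⟩
    (n C 0) * 1 + (q ∸ 1) * (q ^ n * 0)
      ≡⟨ cong (λ z → 1 + (q ∸ 1) * z) (*-zeroʳ (q ^ n)) ⟩
    1 + (q ∸ 1) * 0
      ≡⟨ cong suc (*-zeroʳ (q ∸ 1)) ⟩
    1 ∎
  #weight≡ (suc n) (suc j) = begin
    #weight (suc n) (suc j)
      ≡⟨ #weight-suc n (suc j) ⟩
    #weight n (suc j) + (q ∸ 1) * #weight n j
      ≡⟨ cong₂ (λ a b → a + (q ∸ 1) * b) (#weight≡ n (suc j)) (#weight≡ n j) ⟩
    (n C suc j) * ((q ∸ 1) * r) + (q ∸ 1) * ((n C j) * r)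
      ≡⟨ collect (n C j) (n C suc j) (q ∸ 1) r ⟩
    (n C j + n C suc j) * ((q ∸ 1) * r)
      ≡⟨ cong (_* (q ∸ 1) ^ suc j) (nCk+nC[k+1]≡[n+1]C[k+1] n j) ⟩
    (suc n C suc j) * (q ∸ 1) ^ suc j ∎
    where
    r = (q ∸ 1) ^ j
    collect : ∀ a b s r → b * (s * r) + s * (a * r) ≡ (a + b) * (s * r)
    collect = solve-∀

  -- Sliding windows

  -- Reading past the end of a list gives 0#; every use below stays in range.
  at : List Carrier → ℕ → Carrier
  at []       _       = 0#
  at (x ∷ _)  zero    = x
  at (_ ∷ xs) (suc i) = at xs i

  dot : ∀ {m} → Vec Carrier m → List Carrier → Carrier
  dot []       D = 0#
  dot (u ∷ us) D = u ⊗ at D 0 ⊕ dot us (drop 1 D)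

  windows : ∀ {m} → Vec Carrier m → (n : ℕ) → List Carrier → Vec Carrier n
  windows u zero    D = []
  windows u (suc n) D = dot u D ∷ windows u n (drop 1 D)

  at-drop : ∀ e D i → at (drop e D) i ≡ at D (e + i)
  at-drop zero    D       i = refl
  at-drop (suc e) []      i = refl
  at-drop (suc e) (x ∷ D) i = at-drop e D i

  at-toList : ∀ {n} (v : Vec Carrier n) d → at (toList v) d ≡ idx v d
  at-toList []      d       = refl
  at-toList (x ∷ v) zero    = refl
  at-toList (x ∷ v) (suc d) = at-toList v d

  lookup-windows : ∀ {m} (u : Vec Carrier m) n D (e : Fin n) →
                   lookup (windows u n D) e ≡ dot u (drop (toℕ e) D)
  lookup-windows u (suc n) D Fin.zero    = refl
  lookup-windows u (suc n) D (Fin.suc e) =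
    trans (lookup-windows u n (drop 1 D) e) (cong (dot u) (drop-drop 1 (toℕ e) D))

  sumVec-cong : ∀ {n} {v w : Vec Carrier n} → v ≋ w → sumVec v ≈ sumVec w
  sumVec-cong PW.[]            = ≈-refl
  sumVec-cong (x≈y PW.∷ v≋w) = F.+-cong x≈y (sumVec-cong v≋w)

  dot≈sumVec : ∀ {m} (u : Vec Carrier m) D →
               dot u D ≈ sumVec (tabulate (λ i → lookup u i ⊗ at D (toℕ i)))
  dot≈sumVec []       D = ≈-refl
  dot≈sumVec (x ∷ u) D = F.+-congˡ (≈-trans (dot≈sumVec u (drop 1 D))
    (sumVec-cong (PW.tabulate⁺ (λ i →
      F.*-congˡ {lookup u i} (≈-reflexive (at-drop 1 D (toℕ i)))))))

  _≋ₗ_ : List Carrier → List Carrier → Set (c ⊔ ℓ)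
  _≋ₗ_ = LPW.Pointwise _≈_

  toList-cong : ∀ {n} {v w : Vec Carrier n} → v ≋ w → toList v ≋ₗ toList w
  toList-cong PW.[]            = LPW.[]
  toList-cong (x≈y PW.∷ v≋w) = x≈y LPW.∷ toList-cong v≋w

  dot-cong : ∀ {m} (u : Vec Carrier m) {D D′} → D ≋ₗ D′ → dot u D ≈ dot u D′
  dot-cong []      _                 = ≈-refl
  dot-cong (x ∷ u) LPW.[]            = ≈-refl
  dot-cong (x ∷ u) (d≈d′ LPW.∷ D≋D′) =
    F.+-cong (F.*-congˡ d≈d′) (dot-cong u D≋D′)

  windows-cong : ∀ {m} (u : Vec Carrier m) n {D D′} → D ≋ₗ D′ →
                 windows u n D ≋ windows u n D′
  windows-cong u zero    _                   = PW.[]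
  windows-cong u (suc n) LPW.[]              = V.refl
  windows-cong u (suc n) D≋D′@(_ LPW.∷ tail) =
    dot-cong u D≋D′ PW.∷ windows-cong u n tail

  windows-0#∷ : ∀ {m} {u : Vec Carrier m} {u₀} → u₀ ≈ 0# → ∀ n D →
                windows (u₀ ∷ u) n D ≋ windows u n (drop 1 D)
  windows-0#∷ u₀≈0 zero    D = PW.[]
  windows-0#∷ {u = u} u₀≈0 (suc n) D =
    ≈-trans (F.+-congʳ (≈-trans (F.*-congʳ u₀≈0) (F.zeroˡ (at D 0))))
            (F.+-identityˡ (dot u (drop 1 D)))
    PW.∷ windows-0#∷ u₀≈0 n (drop 1 D)

  ∑-affine : ∀ {u} → ¬ u ≈ 0# → ∀ β (h : Carrier → ℕ) → h Preserves _≈_ ⟶ _≡_ →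
             ∑[ x ∈ elements ] h (u ⊗ x ⊕ β) ≡ ∑ elements h
  ∑-affine {u} u≉0 β = Fᴱ.∑-reindex f g
    (mk⇔ (λ fx≈y → ≈-trans (g-cong (≈-sym fx≈y)) (g∘f _))
         (λ gy≈x → ≈-trans (f-cong (≈-sym gy≈x)) (f∘g _)))
    where
    v = proj₁ (F.inverse u u≉0)
    u⊗v≈1 : u ⊗ v ≈ 1#
    u⊗v≈1 = proj₂ (F.inverse u u≉0)
    f g : Carrier → Carrier
    f x = u ⊗ x ⊕ β
    g y = v ⊗ (y ⊕ ⊖ β)
    f-cong : ∀ {x y} → x ≈ y → f x ≈ f y
    f-cong x≈y = F.+-congʳ (F.*-congˡ x≈y)
    g-cong : ∀ {x y} → x ≈ y → g x ≈ g y
    g-cong x≈y = F.*-congˡ (F.+-congʳ x≈y)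
    cancel : ∀ w γ → w ⊕ γ ⊕ ⊖ γ ≈ w
    cancel w γ = ≈-trans (F.+-assoc w γ (⊖ γ))
                         (≈-trans (F.+-congˡ (F.-‿inverseʳ γ)) (F.+-identityʳ w))
    cancel′ : ∀ w γ → w ⊕ ⊖ γ ⊕ γ ≈ w
    cancel′ w γ = ≈-trans (F.+-assoc w (⊖ γ) γ)
                          (≈-trans (F.+-congˡ (F.-‿inverseˡ γ)) (F.+-identityʳ w))
    g∘f : ∀ x → g (f x) ≈ x
    g∘f x = ≈-trans (F.*-congˡ (cancel (u ⊗ x) β)) (≈-trans (≈-sym (F.*-assoc v u x))
      (≈-trans (F.*-congʳ (≈-trans (F.*-comm v u) u⊗v≈1)) (F.*-identityˡ x)))
    f∘g : ∀ y → f (g y) ≈ y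
    f∘g y = ≈-trans (F.+-congʳ (≈-trans (≈-sym (F.*-assoc u v _))
      (≈-trans (F.*-congʳ u⊗v≈1) (F.*-identityˡ _)))) (cancel′ y β)

  -- The first window is u₀ c₀ + (terms not involving c₀), and the remaining
  -- windows do not involve c₀ at all: summing over c₀ first absorbs the affine shift.
  ∑-windows-head≉0 : ∀ {k} {u₀} (u : Vec Carrier k) → ¬ u₀ ≈ 0# →
    ∀ n (g : Vec Carrier n → ℕ) → g Preserves _≋_ ⟶ _≡_ →
    ∑[ C ∈ vecs (n + k) ] g (windows (u₀ ∷ u) n (toList C)) ≡ q ^ k * ∑ (vecs n) g
  ∑-windows-head≉0 {k} u u₀≉0 zero g g-resp =
    trans (∑-vecs-const k (g [])) (cong (q ^ k *_) (sym (+-identityʳ (g []))))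
  ∑-windows-head≉0 {k} {u₀} u u₀≉0 (suc n) g g-resp = begin
    ∑[ C ∈ vecs (suc n + k) ] g (windows (u₀ ∷ u) (suc n) (toList C))
      ≡⟨ ∑-vecs-suc (n + k) _ ⟩
    ∑[ c₀ ∈ elements ] ∑[ C ∈ vecs (n + k) ] g ((u₀ ⊗ c₀ ⊕ dot u (toList C)) ∷ rest C)
      ≡⟨ ∑-comm elements (vecs (n + k)) _ ⟩
    ∑[ C ∈ vecs (n + k) ] ∑[ c₀ ∈ elements ] g ((u₀ ⊗ c₀ ⊕ dot u (toList C)) ∷ rest C)
      ≡⟨ ∑-cong (λ C → ∑-affine u₀≉0 (dot u (toList C)) (λ y → g (y ∷ rest C))
                         (λ y≈y′ → g-resp (y≈y′ PW.∷ V.refl))) (vecs (n + k)) ⟩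
    ∑[ C ∈ vecs (n + k) ] ∑[ c₀ ∈ elements ] g (c₀ ∷ rest C)
      ≡⟨ ∑-comm (vecs (n + k)) elements _ ⟩
    ∑[ c₀ ∈ elements ] ∑[ C ∈ vecs (n + k) ] g (c₀ ∷ rest C)
      ≡⟨ ∑-cong (λ c₀ → ∑-windows-head≉0 u u₀≉0 n (g ∘ (c₀ ∷_)) (g-resp ∘ (≈-refl PW.∷_)))
                elements ⟩
    ∑[ c₀ ∈ elements ] (q ^ k * ∑[ w ∈ vecs n ] g (c₀ ∷ w))
      ≡⟨ ∑-*ˡ (q ^ k) elements _ ⟩
    q ^ k * ∑[ c₀ ∈ elements ] ∑[ w ∈ vecs n ] g (c₀ ∷ w)
      ≡⟨ cong (q ^ k *_) (sym (∑-vecs-suc n g)) ⟩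
    q ^ k * ∑ (vecs (suc n)) g ∎
    where
    rest : Vec Carrier (n + k) → Vec Carrier n
    rest C = windows (u₀ ∷ u) n (toList C)

  NonZero : ∀ {n} → Vec Carrier n → Set (c ⊔ ℓ)
  NonZero = VecAny.Any (λ x → ¬ x ≈ 0#)

  -- If u₀ ≈ 0 the windows ignore c₀, which only contributes a factor q. The length l is
  -- kept apart from n + k since that case needs n + suc k to be suc (n + k).
  ∑-windows : ∀ {k} (u : Vec Carrier (suc k)) → NonZero u → ∀ n {l} → l ≡ n + k →
    (g : Vec Carrier n → ℕ) → g Preserves _≋_ ⟶ _≡_ →
    ∑[ C ∈ vecs l ] g (windows u n (toList C)) ≡ q ^ k * ∑ (vecs n) g
  ∑-windows (u₀ ∷ u) (VecAny.here u₀≉0) n refl = ∑-windows-head≉0 u u₀≉0 n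
  ∑-windows {suc k} (u₀ ∷ u) (VecAny.there u≢0) n {l} l≡n+k g g-resp with u₀ ≟ 0#
  ... | no u₀≉0 rewrite l≡n+k = ∑-windows-head≉0 u u₀≉0 n g g-resp
  ... | yes u₀≈0 rewrite trans l≡n+k (+-suc n k) = begin
    ∑[ C ∈ vecs (suc (n + k)) ] g (windows (u₀ ∷ u) n (toList C))
      ≡⟨ ∑-vecs-suc (n + k) _ ⟩
    ∑[ c₀ ∈ elements ] ∑[ C ∈ vecs (n + k) ] g (windows (u₀ ∷ u) n (c₀ ∷ toList C))
      ≡⟨ ∑-cong (λ c₀ → ∑-cong (λ C → g-resp (windows-0#∷ u₀≈0 n (c₀ ∷ toList C))) (vecs (n + k)))
                elements ⟩
    ∑[ c₀ ∈ elements ] ∑[ C ∈ vecs (n + k) ] g (windows u n (toList C))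
      ≡⟨ ∑-cong (λ c₀ → ∑-windows u u≢0 n refl g g-resp) elements ⟩
    ∑[ c₀ ∈ elements ] (q ^ k * ∑ (vecs n) g)
      ≡⟨ ∑-const elements _ ⟩
    q * (q ^ k * ∑ (vecs n) g)
      ≡⟨ sym (*-assoc q (q ^ k) _) ⟩
    q ^ suc k * ∑ (vecs n) g ∎

  -- Toeplitz matrices as windows

  idx-lookup : ∀ {n} (v : Vec Carrier n) (i : Fin n) → idx v (toℕ i) ≡ lookup v i
  idx-lookup (x ∷ v) Fin.zero    = refl
  idx-lookup (x ∷ v) (Fin.suc i) = idx-lookup v i

  idx-++ˡ : ∀ {m n} (v : Vec Carrier m) (w : Vec Carrier n) {d} → d < m →
            idx (v ++ w) d ≡ idx v d
  idx-++ˡ (x ∷ v) w {zero}  _         = refl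
  idx-++ˡ (x ∷ v) w {suc d} (s≤s d<m) = idx-++ˡ v w d<m

  idx-++ʳ : ∀ {m n} (v : Vec Carrier m) (w : Vec Carrier n) d →
            idx (v ++ w) (m + d) ≡ idx w d
  idx-++ʳ []      w d = refl
  idx-++ʳ (x ∷ v) w d = idx-++ʳ v w d

  idx-rev : ∀ {k} (a : Vec Carrier k) {e} → e < k → idx (rev a) e ≡ idx a (k ∸ suc e)
  idx-rev {k} a {e} e<k = begin
    idx (rev a) e             ≡⟨ cong (idx (rev a)) (sym (toℕ-fromℕ< e<k)) ⟩
    idx (rev a) (toℕ i)       ≡⟨ idx-lookup (rev a) i ⟩
    lookup (rev a) i          ≡⟨ lookup∘tabulate _ i ⟩
    lookup a (opposite i)     ≡⟨ sym (idx-lookup a (opposite i)) ⟩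
    idx a (toℕ (opposite i))  ≡⟨ cong (idx a) (opposite-prop i) ⟩
    idx a (k ∸ suc (toℕ i))   ≡⟨ cong (λ d → idx a (k ∸ suc d)) (toℕ-fromℕ< e<k) ⟩
    idx a (k ∸ suc e)         ∎
    where i = fromℕ< e<k

  idx-ext : ∀ {n} (v w : Vec Carrier n) → (∀ d → d < n → idx v d ≈ idx w d) → v ≋ w
  idx-ext []      []      _    = PW.[]
  idx-ext (x ∷ v) (y ∷ w) v≈w =
    v≈w 0 (s≤s z≤n) PW.∷ idx-ext v w (λ d d<n → v≈w (suc d) (s≤s d<n))

  -- T(t,a,b) is the Toeplitz matrix of the sequence (a_{m-1},…,a_1,t,b_1,…,b_{m-1}):
  -- entry (i,j) is its term of (0-based) index (m-1) - j + i.
  Φ : ∀ {k} → Params k → Vec Carrier (k + suc k)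
  Φ (t , a , b) = rev a ++ t ∷ b

  toeplitz≡idx-Φ : ∀ {k} (p : Params k) (i j : Fin (suc k)) →
                   toeplitz p i j ≡ idx (Φ p) (k ∸ toℕ j + toℕ i)
  toeplitz≡idx-Φ {k} (t , a , b) i j = entry (toℕ i) (toℕ j) (toℕ≤pred[n] j)
    where
    entry : ∀ I J → J ≤ k →
      (if I ≡ᵇ J then t else if I <ᵇ J then idx a (J ∸ I ∸ 1) else idx b (I ∸ J ∸ 1))
      ≡ idx (rev a ++ t ∷ b) (k ∸ J + I)
    entry I J J≤k with <-cmp I J
    ... | tri< I<J I≢J _
      rewrite ¬T⇒≡false (I≢J ∘ ≡ᵇ⇒≡ I J) | Equivalence.to T-≡ (<⇒<ᵇ I<J) = begin
      idx a (J ∸ I ∸ 1)                 ≡⟨ cong (idx a) (sym (k∸[1+k∸j+i]≡j∸i∸1 J≤k)) ⟩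
      idx a (k ∸ suc (k ∸ J + I))       ≡⟨ sym (idx-rev a (k∸j+i<k J≤k I<J)) ⟩
      idx (rev a) (k ∸ J + I)           ≡⟨ sym (idx-++ˡ (rev a) (t ∷ b) (k∸j+i<k J≤k I<J)) ⟩
      idx (rev a ++ t ∷ b) (k ∸ J + I)  ∎
    ... | tri≈ _ refl _
      rewrite Equivalence.to T-≡ (≡⇒≡ᵇ I I refl) = begin
      t                                 ≡⟨ sym (idx-++ʳ (rev a) (t ∷ b) 0) ⟩
      idx (rev a ++ t ∷ b) (k + 0)      ≡⟨ cong (idx (rev a ++ t ∷ b)) k≡k∸I+I ⟩
      idx (rev a ++ t ∷ b) (k ∸ I + I)  ∎
      where k≡k∸I+I = trans (+-identityʳ k) (sym (m∸n+n≡m J≤k))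
    ... | tri> _ I≢J J<I
      rewrite ¬T⇒≡false (I≢J ∘ ≡ᵇ⇒≡ I J) | ¬T⇒≡false (<⇒≯ J<I ∘ <ᵇ⇒< I J) = begin
      idx b (I ∸ J ∸ 1)
        ≡⟨ sym (idx-++ʳ (rev a) (t ∷ b) (suc (I ∸ J ∸ 1))) ⟩
      idx (rev a ++ t ∷ b) (k + suc (I ∸ J ∸ 1))
        ≡⟨ cong (idx (rev a ++ t ∷ b)) (sym (k∸j+i≡k+suc[i∸j∸1] J≤k J<I)) ⟩
      idx (rev a ++ t ∷ b) (k ∸ J + I) ∎

  _·T_ : ∀ {k} → Vec Carrier (suc k) → Params k → Vec Carrier (suc k)
  x ·T p = tabulate (λ j → sumVec (tabulate (λ i → lookup x i ⊗ toeplitz p i j)))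

  ·T-congˡ : ∀ {k} {x x′ : Vec Carrier (suc k)} (p : Params k) → x ≋ x′ → x ·T p ≋ x′ ·T p
  ·T-congˡ p x≋x′ = PW.tabulate⁺ (λ j → sumVec-cong (PW.tabulate⁺ (λ i →
    F.*-congʳ {toeplitz p i j} (PW.lookup x≋x′ i))))

  ·T≋rev-windows : ∀ {k} (x : Vec Carrier (suc k)) p →
                   x ·T p ≋ rev (windows x (suc k) (toList (Φ p)))
  ·T≋rev-windows {k} x p = PW.tabulate⁺ entry
    where
    D = toList (Φ p)
    toeplitz≡at : ∀ i j → toeplitz p i j ≡ at (drop (toℕ (opposite j)) D) (toℕ i)
    toeplitz≡at i j = begin
      toeplitz p i j
        ≡⟨ toeplitz≡idx-Φ p i j ⟩
      idx (Φ p) (k ∸ toℕ j + toℕ i)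
        ≡⟨ cong (λ o → idx (Φ p) (o + toℕ i)) (sym (opposite-prop j)) ⟩
      idx (Φ p) (toℕ (opposite j) + toℕ i)
        ≡⟨ sym (at-toList (Φ p) _) ⟩
      at D (toℕ (opposite j) + toℕ i)
        ≡⟨ sym (at-drop (toℕ (opposite j)) D (toℕ i)) ⟩
      at (drop (toℕ (opposite j)) D) (toℕ i) ∎
    entry : ∀ j → sumVec (tabulate (λ i → lookup x i ⊗ toeplitz p i j))
                  ≈ lookup (windows x (suc k) D) (opposite j)
    entry j = ≈-trans
      (sumVec-cong (PW.tabulate⁺ (λ i → F.*-congˡ {lookup x i} (≈-reflexive (toeplitz≡at i j)))))
      (≈-trans (≈-sym (dot≈sumVec x _))
               (≈-reflexive (sym (lookup-windows x (suc k) D (opposite j)))))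

  rev-cong : ∀ {n} {v w : Vec Carrier n} → v ≋ w → rev v ≋ rev w
  rev-cong v≋w = PW.tabulate⁺ (λ i → PW.lookup v≋w (opposite i))

  rev-inverse : ∀ {n} {v w : Vec Carrier n} → rev v ≋ w ⇔ rev w ≋ v
  rev-inverse {v = v} {w} = mk⇔
    (λ rv≋w → V.trans (rev-cong (V.sym rv≋w)) (V.reflexive (rev-involutive v)))
    (λ rw≋v → V.trans (rev-cong (V.sym rw≋v)) (V.reflexive (rev-involutive w)))

  ∑-params-Φ : ∀ k (G : Vec Carrier (k + suc k) → ℕ) → G Preserves _≋_ ⟶ _≡_ →
               ∑[ p ∈ allParams k ] G (Φ p) ≡ ∑ (vecs (k + suc k)) G
  ∑-params-Φ k G G-resp = begin
    ∑[ p ∈ allParams k ] G (Φ p)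
      ≡⟨ ∑-params k (G ∘ Φ) ⟩
    ∑[ t ∈ elements ] ∑[ a ∈ vecs k ] ∑[ b ∈ vecs k ] G (rev a ++ t ∷ b)
      ≡⟨ ∑-comm elements (vecs k) _ ⟩
    ∑[ a ∈ vecs k ] H (rev a)
      ≡⟨ Vᴱ.∑-reindex rev rev rev-inverse H H-resp ⟩
    ∑[ a ∈ vecs k ] H a
      ≡⟨ ∑-cong (λ a → sym (∑-vecs-suc k (G ∘ (a ++_)))) (vecs k) ⟩
    ∑[ a ∈ vecs k ] ∑[ tb ∈ vecs (suc k) ] G (a ++ tb)
      ≡⟨ sym (∑-vecs-++ k (suc k) G) ⟩
    ∑ (vecs (k + suc k)) G ∎
    where
    H : Vec Carrier k → ℕ
    H a = ∑[ t ∈ elements ] ∑[ b ∈ vecs k ] G (a ++ t ∷ b)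
    H-resp : H Preserves _≋_ ⟶ _≡_
    H-resp a≋a′ =
      ∑-cong (λ t → ∑-cong (λ b → G-resp (PW.++⁺ a≋a′ V.refl)) (vecs k)) elements

  ∑-params-·T : ∀ {k} (x : Vec Carrier (suc k)) → NonZero x →
    (g : Vec Carrier (suc k) → ℕ) → g Preserves _≋_ ⟶ _≡_ →
    ∑[ p ∈ allParams k ] g (x ·T p) ≡ q ^ k * ∑ (vecs (suc k)) g
  ∑-params-·T {k} x x≢0 g g-resp = begin
    ∑[ p ∈ allParams k ] g (x ·T p)
      ≡⟨ ∑-cong (λ p → g-resp (·T≋rev-windows x p)) (allParams k) ⟩
    ∑[ p ∈ allParams k ] G (Φ p)
      ≡⟨ ∑-params-Φ k G (g-resp ∘ rev-cong ∘ windows-cong x (suc k) ∘ toList-cong) ⟩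
    ∑ (vecs (k + suc k)) G
      ≡⟨ ∑-windows x x≢0 (suc k) (+-suc k k) (g ∘ rev) (g-resp ∘ rev-cong) ⟩
    q ^ k * ∑[ y ∈ vecs (suc k) ] g (rev y)
      ≡⟨ cong (q ^ k *_) (Vᴱ.∑-reindex rev rev rev-inverse g g-resp) ⟩
    q ^ k * ∑ (vecs (suc k)) g ∎
    where
    G : Vec Carrier (k + suc k) → ℕ
    G C = g (rev (windows x (suc k) (toList C)))

  T-eqVec : ∀ {n} (v w : Vec Carrier n) → T (eqVec v w) ⇔ v ≋ w
  T-eqVec []      []      = mk⇔ (λ _ → PW.[]) (λ _ → _)
  T-eqVec (x ∷ v) (y ∷ w) = mk⇔
    (λ t → let tx , tv = Equivalence.to T-∧ t in
             toWitness tx PW.∷ Equivalence.to (T-eqVec v w) tv)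
    (λ { (x≈y PW.∷ v≋w) →
           Equivalence.from T-∧ (fromWitness x≈y , Equivalence.from (T-eqVec v w) v≋w) })

  inCode-resp : ∀ {k} (p : Params k) {v w} → v ≋ w → T (inCode p v) → T (inCode p w)
  inCode-resp {k} p {v} {w} v≋w t =
    Anyₚ.any⁺ _ (Any.map (λ {x} → move {x}) (Anyₚ.any⁻ _ (vecs (suc k)) t))
    where
    move : ∀ {x} → T (eqVec (encode p x) v) → T (eqVec (encode p x) w)
    move {x} t = Equivalence.from (T-eqVec (encode p x) w)
                   (V.trans (Equivalence.to (T-eqVec (encode p x) v) t) v≋w)

  inCode-++ : ∀ {k} (p : Params k) x y → T (inCode p (x ++ y)) ⇔ x ·T p ≋ y
  inCode-++ {k} p x y = mk⇔
    (λ t → proj₂ (Any.satisfied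
             (Any.map (λ {x′} → sound {x′}) (Anyₚ.any⁻ _ (vecs (suc k)) t))))
    (λ x·T≋y → Anyₚ.any⁺ _ (Any.map (complete x·T≋y) (vecs-complete (suc k) x)))
    where
    sound : ∀ {x′} → T (eqVec (x′ ++ x′ ·T p) (x ++ y)) → x ·T p ≋ y
    sound {x′} t with PW.++⁻ x′ x (Equivalence.to (T-eqVec (x′ ++ x′ ·T p) (x ++ y)) t)
    ... | x′≋x , x′·T≋y = V.trans (·T-congˡ p (V.sym x′≋x)) x′·T≋y
    complete : x ·T p ≋ y → ∀ {x′} → x ≋ x′ → T (eqVec (x′ ++ x′ ·T p) (x ++ y))
    complete x·T≋y {x′} x≋x′ = Equivalence.from (T-eqVec (x′ ++ x′ ·T p) (x ++ y))
      (PW.++⁺ (V.sym x≋x′) (V.trans (·T-congˡ p (V.sym x≋x′)) x·T≋y))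

  weightCount≡ : ∀ {k} (p : Params k) j →
                 weightCount p j ≡ ∑[ x ∈ vecs (suc k) ] 𝟙 (wt x + wt (x ·T p) ≡ᵇ j)
  weightCount≡ {k} p j = begin
    weightCount p j
      ≡⟨ length-filter _ (vecs (m + m)) ⟩
    ∑[ v ∈ vecs (m + m) ] 𝟙 (inCode p v ∧ (wt v ≡ᵇ j))
      ≡⟨ ∑-vecs-++ m m _ ⟩
    ∑[ x ∈ vecs m ] ∑[ y ∈ vecs m ] 𝟙 (inCode p (x ++ y) ∧ (wt (x ++ y) ≡ᵇ j))
      ≡⟨ ∑-cong (λ x → ∑-cong (codeword x) (vecs m)) (vecs m) ⟩
    ∑[ x ∈ vecs m ] ∑[ y ∈ vecs m ] Vᴱ.δ (x ·T p) y (𝟙 (wt x + wt y ≡ᵇ j))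
      ≡⟨ ∑-cong (λ x → Vᴱ.∑-δ (x ·T p) _ (cong (λ w → 𝟙 (wt x + w ≡ᵇ j)) ∘ wt-cong)) (vecs m) ⟩
    ∑[ x ∈ vecs m ] 𝟙 (wt x + wt (x ·T p) ≡ᵇ j) ∎
    where
    m = suc k
    codeword : ∀ x y → 𝟙 (inCode p (x ++ y) ∧ (wt (x ++ y) ≡ᵇ j))
                       ≡ Vᴱ.δ (x ·T p) y (𝟙 (wt x + wt y ≡ᵇ j))
    codeword x y rewrite T⇔-⌊⌋ _ (inCode-++ p x y) (x ·T p V.≟ y) | wt-++ x y
      with x ·T p V.≟ y
    ... | yes _ = refl
    ... | no  _ = refl

  basis : ∀ {n} → Fin n → Vec Carrier n
  basis {suc n} Fin.zero    = 1# ∷ zeros n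
  basis {suc n} (Fin.suc i) = 0# ∷ basis i

  dot-zeros : ∀ n D → dot (zeros n) D ≈ 0#
  dot-zeros zero    D = ≈-refl
  dot-zeros (suc n) D =
    ≈-trans (F.+-cong (F.zeroˡ (at D 0)) (dot-zeros n (drop 1 D))) (F.+-identityˡ 0#)

  dot-basis : ∀ {n} (i : Fin n) D → dot (basis i) D ≈ at D (toℕ i)
  dot-basis {suc n} Fin.zero    D =
    ≈-trans (F.+-cong (F.*-identityˡ (at D 0)) (dot-zeros n (drop 1 D)))
            (F.+-identityʳ (at D 0))
  dot-basis {suc n} (Fin.suc i) D =
    ≈-trans (F.+-cong (F.zeroˡ (at D 0)) (dot-basis i (drop 1 D)))
            (≈-trans (F.+-identityˡ _) (≈-reflexive (at-drop 1 D (toℕ i))))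

  lookup-windows-basis : ∀ {m} (i : Fin m) n D (e : Fin n) →
                         lookup (windows (basis i) n D) e ≈ at D (toℕ e + toℕ i)
  lookup-windows-basis i n D e = ≈-trans (≈-reflexive (lookup-windows (basis i) n D e))
    (≈-trans (dot-basis i (drop (toℕ e) D)) (≈-reflexive (at-drop (toℕ e) D (toℕ i))))

  -- Every position d ≤ 2k is e + 0 or e + k with e ≤ k, so the windows of
  -- the unit messages e₀ and e_k together read the whole sequence.
  windows-injective : ∀ {k} D D′ → (∀ x → windows x (suc k) D ≋ windows x (suc k) D′) →
                      ∀ d → d < k + suc k → at D d ≈ at D′ d
  windows-injective {k} D D′ same d d<2k+1 = by-position (d ≤? k)
    where
    read : ∀ (i e : Fin (suc k)) → at D (toℕ e + toℕ i) ≈ at D′ (toℕ e + toℕ i)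
    read i e = ≈-trans (≈-sym (lookup-windows-basis i (suc k) D e))
                       (≈-trans (PW.lookup (same (basis i)) e)
                                (lookup-windows-basis i (suc k) D′ e))
    by-position : Dec (d ≤ k) → at D d ≈ at D′ d
    by-position (yes d≤k) = subst (λ d → at D d ≈ at D′ d)
      (trans (+-identityʳ _) (toℕ-fromℕ< (s≤s d≤k))) (read Fin.zero (fromℕ< (s≤s d≤k)))
    by-position (no d≰k) = subst (λ d → at D d ≈ at D′ d)
      (trans (cong₂ _+_ (toℕ-fromℕ< d∸k<1+k) (toℕ-fromℕ k)) (m∸n+n≡m k≤d))
      (read (fromℕ k) (fromℕ< d∸k<1+k))
      where
      k≤d = <⇒≤ (≰⇒> d≰k)
      d∸k<1+k : d ∸ k < suc k
      d∸k<1+k = subst (d ∸ k <_) (m+n∸m≡n k (suc k)) (∸-monoˡ-< d<2k+1 k≤d)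

  _≈ₚ_ : ∀ {k} → Params k → Params k → Set (c ⊔ ℓ)
  (t , a , b) ≈ₚ (t′ , a′ , b′) = t ≈ t′ × a ≋ a′ × b ≋ b′

  ·T-injective : ∀ {k} (p p′ : Params k) → (∀ x → x ·T p ≋ x ·T p′) → p ≈ₚ p′
  ·T-injective {k} p@(t , a , b) p′@(t′ , a′ , b′) same
    with PW.++⁻ (rev a) (rev a′) (idx-ext (Φ p) (Φ p′) Φ-agree)
    where
    windows-agree : ∀ x → windows x (suc k) (toList (Φ p)) ≋ windows x (suc k) (toList (Φ p′))
    windows-agree x =
      V.trans (V.sym (Equivalence.to rev-inverse rev-agree)) (V.reflexive (rev-involutive _))
      where
      rev-agree = V.trans (V.sym (·T≋rev-windows x p)) (V.trans (same x) (·T≋rev-windows x p′))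
    Φ-agree : ∀ d → d < k + suc k → idx (Φ p) d ≈ idx (Φ p′) d
    Φ-agree d d< = subst₂ _≈_ (at-toList (Φ p) d) (at-toList (Φ p′) d)
                          (windows-injective _ _ windows-agree d d<)
  ... | rev-a≋rev-a′ , t∷b≋t′∷b′ =
    PW.head t∷b≋t′∷b′ ,
    V.trans (V.reflexive (sym (rev-involutive a)))
            (V.trans (rev-cong rev-a≋rev-a′) (V.reflexive (rev-involutive a′))) ,
    PW.tail t∷b≋t′∷b′

  sameCode⇒·T≋ : ∀ {k} (p′ p : Params k) → T (sameCode p′ p) → ∀ x → x ·T p ≋ x ·T p′
  sameCode⇒·T≋ {k} p′ p same x =
    Equivalence.to (inCode-++ p x (x ·T p′)) (inCode-resp p (V.sym v≋v′) (p′⊆p in-p′))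
    where
    v = x ++ x ·T p′
    found = All.lookupAny (Allₚ.all⁺ _ _ (proj₁ (Equivalence.to T-∧ same)))
                          (vecs-complete _ v)
    v′ = Any.lookup (vecs-complete _ v)
    v≋v′ : v ≋ v′
    v≋v′ = proj₂ found
    p′⊆p : T (inCode p′ v′) → T (inCode p v′)
    p′⊆p with inCode p′ v′ | proj₁ found
    ... | true | in-p = λ _ → in-p
    in-p′ : T (inCode p′ v′)
    in-p′ = inCode-resp p′ v≋v′ (Equivalence.from (inCode-++ p′ x (x ·T p′)) V.refl)

  sameCode-false : ∀ {k} (p p′ : Params k) → ¬ p ≈ₚ p′ → sameCode p′ p ≡ false
  sameCode-false p p′ p≉p′ = ¬T⇒≡false (p≉p′ ∘ ·T-injective p p′ ∘ sameCode⇒·T≋ p′ p)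

  allParams-distinct : ∀ k → AllPairs (λ p p′ → ¬ p ≈ₚ p′) (allParams k)
  allParams-distinct k = allPairs-concatMap⁺ _ proj₁
    (λ t → Allₚ.concat⁺ (Allₚ.map⁺ (All.universal (λ a →
      Allₚ.map⁺ (All.universal (λ _ → refl) (vecs k))) (vecs k))))
    (λ t≉t′ p≈p′ → t≉t′ (proj₁ p≈p′))
    (λ t → allPairs-concatMap⁺ _ (proj₁ ∘ proj₂)
      (λ a → Allₚ.map⁺ (All.universal (λ _ → refl) (vecs k)))
      (λ a≉a′ p≈p′ → a≉a′ (proj₁ (proj₂ p≈p′)))
      (λ a → AllPairsₚ.map⁺
        (AllPairs.map (λ b≉b′ p≈p′ → b≉b′ (proj₂ (proj₂ p≈p′))) (vecs-distinct k)))
      (vecs-distinct k))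
    F.distinct

  dedup-id : ∀ {k} (seen ps : List (Params k)) →
    All (λ p → All (λ s → sameCode p s ≡ false) seen) ps →
    AllPairs (λ p p′ → sameCode p′ p ≡ false) ps → dedup seen ps ≡ ps
  dedup-id seen []       _                _                       = refl
  dedup-id seen (p ∷ ps) (p-new ∷ ps-new) (p-first ∷ ps-distinct)
    rewrite any-false (sameCode p) p-new =
      cong (p ∷_) (dedup-id (p ∷ seen) ps
        (All.zipWith (λ (x , y) → x ∷ y) (p-first , ps-new)) ps-distinct)

  Ω≡allParams : ∀ k → Ω k ≡ allParams k
  Ω≡allParams k = dedup-id [] (allParams k) (All.universal (λ _ → []) _)
    (AllPairs.map (λ {p} {p′} → sameCode-false p p′) (allParams-distinct k))

  sumVec-zeros : ∀ n → sumVec (zeros n) ≈ 0#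
  sumVec-zeros zero    = ≈-refl
  sumVec-zeros (suc n) = ≈-trans (F.+-congˡ (sumVec-zeros n)) (F.+-identityʳ 0#)

  zeros·T : ∀ {k} (p : Params k) → zeros (suc k) ·T p ≋ zeros (suc k)
  zeros·T {k} p = PW.tabulate⁺ (λ j → ≈-trans (sumVec-cong (PW.tabulate⁺ (λ i →
    ≈-trans (F.*-congʳ (≈-reflexive (lookup∘tabulate _ i))) (F.zeroˡ (toeplitz p i j)))))
    (sumVec-zeros (suc k)))

  nonZero : ∀ {n} {x : Vec Carrier n} → ¬ zeros n ≋ x → NonZero x
  nonZero {x = []}     0≉x = contradiction PW.[] 0≉x
  nonZero {x = x ∷ xs} 0≉x with x ≟ 0#
  ... | no  x≉0 = VecAny.here x≉0
  ... | yes x≈0 = VecAny.there (nonZero (0≉x ∘ (≈-sym x≈0 PW.∷_)))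

  #params-of-weight : ∀ {k} → Vec Carrier (suc k) → ℕ → ℕ
  #params-of-weight {k} x j = ∑[ p ∈ allParams k ] 𝟙 (wt x + wt (x ·T p) ≡ᵇ j)

  #partners : ∀ {n} → Vec Carrier n → ℕ → ℕ
  #partners {n} x j = ∑[ y ∈ vecs n ] 𝟙 (wt x + wt y ≡ᵇ j)

  Ψcoeff≡∑ : ∀ k j → Ψcoeff k j ≡ ∑[ x ∈ vecs (suc k) ] #params-of-weight x j
  Ψcoeff≡∑ k j = begin
    Ψcoeff k j
      ≡⟨ sum-map _ (Ω k) ⟩
    ∑[ p ∈ Ω k ] weightCount p j
      ≡⟨ cong (λ ps → ∑[ p ∈ ps ] weightCount p j) (Ω≡allParams k) ⟩
    ∑[ p ∈ allParams k ] weightCount p j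
      ≡⟨ ∑-cong (λ p → weightCount≡ p j) (allParams k) ⟩
    ∑[ p ∈ allParams k ] ∑[ x ∈ vecs (suc k) ] 𝟙 (wt x + wt (x ·T p) ≡ᵇ j)
      ≡⟨ ∑-comm (allParams k) (vecs (suc k)) _ ⟩
    ∑[ x ∈ vecs (suc k) ] #params-of-weight x j ∎

  #params-of-weight-zeros : ∀ k j →
    #params-of-weight (zeros (suc k)) j ≡ q ^ (k + suc k) * 𝟙 (0 ≡ᵇ j)
  #params-of-weight-zeros k j = trans (∑-cong weight-0 (allParams k)) (∑-params-const k _)
    where
    weight-0 : ∀ p → 𝟙 (wt (zeros (suc k)) + wt (zeros (suc k) ·T p) ≡ᵇ j) ≡ 𝟙 (0 ≡ᵇ j)
    weight-0 p = cong (λ w → 𝟙 (w ≡ᵇ j)) (cong₂ _+_ (wt-zeros (suc k))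
                                              (trans (wt-cong (zeros·T p)) (wt-zeros (suc k))))

  #params-of-weight-nonzero : ∀ {k} (x : Vec Carrier (suc k)) → NonZero x → ∀ j →
                              #params-of-weight x j ≡ q ^ k * #partners x j
  #params-of-weight-nonzero x x≢0 j =
    ∑-params-·T x x≢0 (λ y → 𝟙 (wt x + wt y ≡ᵇ j)) (cong (λ w → 𝟙 (wt x + w ≡ᵇ j)) ∘ wt-cong)

  #partners-resp : ∀ {n} j → (λ (x : Vec Carrier n) → #partners x j) Preserves _≋_ ⟶ _≡_
  #partners-resp {n} j x≋x′ =
    ∑-cong (λ y → cong (λ w → 𝟙 (w + wt y ≡ᵇ j)) (wt-cong x≋x′)) (vecs n)

  #partners-zeros : ∀ n j → #partners (zeros n) j ≡ #weight n j
  #partners-zeros n j = ∑-cong (λ y → cong (λ w → 𝟙 (w + wt y ≡ᵇ j)) (wt-zeros n)) (vecs n)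

  ∑-#partners : ∀ n j → ∑[ x ∈ vecs n ] #partners x j ≡ #weight (n + n) j
  ∑-#partners n j = sym (trans (∑-vecs-++ n n _)
    (∑-cong (λ x → ∑-cong (λ y → cong (λ w → 𝟙 (w ≡ᵇ j)) (wt-++ x y)) (vecs n)) (vecs n)))

  ∑-δᶜ-scaled-#partners : ∀ s n j →
    ∑[ x ∈ vecs n ] Vᴱ.δᶜ (zeros n) x (s * #partners x j) ≡
    s * (#weight (n + n) j ∸ #weight n j)
  ∑-δᶜ-scaled-#partners s n j = begin
    ∑[ x ∈ vecs n ] Vᴱ.δᶜ (zeros n) x (s * #partners x j)
      ≡⟨ Vᴱ.∑-δᶜ (zeros n) (λ x → s * #partners x j) (cong (s *_) ∘ #partners-resp j) ⟩
    ∑[ x ∈ vecs n ] (s * #partners x j) ∸ s * #partners (zeros n) j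
      ≡⟨ cong₂ _∸_ (∑-*ˡ s (vecs n) _) (cong (s *_) (#partners-zeros n j)) ⟩
    s * ∑[ x ∈ vecs n ] #partners x j ∸ s * #weight n j
      ≡⟨ cong (λ t → s * t ∸ s * #weight n j) (∑-#partners n j) ⟩
    s * #weight (n + n) j ∸ s * #weight n j
      ≡⟨ sym (*-distribˡ-∸ s _ _) ⟩
    s * (#weight (n + n) j ∸ #weight n j) ∎

  Ψcoeff-formula : ∀ k j →
    Ψcoeff k j ≡ splitCoeff q k j (#weight (suc k + suc k) j) (#weight (suc k) j)
  Ψcoeff-formula k j = begin
    Ψcoeff k j
      ≡⟨ Ψcoeff≡∑ k j ⟩
    ∑[ x ∈ vecs (suc k) ] #params-of-weight x j
      ≡⟨ Vᴱ.∑-split 0ᵐ _ resp ⟩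
    #params-of-weight 0ᵐ j + ∑[ x ∈ vecs (suc k) ] Vᴱ.δᶜ 0ᵐ x (#params-of-weight x j)
      ≡⟨ cong₂ _+_ (#params-of-weight-zeros k j)
                   (Vᴱ.∑-δᶜ-cong 0ᵐ (λ x 0≉x → #params-of-weight-nonzero x (nonZero 0≉x) j)) ⟩
    q ^ (k + suc k) * 𝟙 (0 ≡ᵇ j) + ∑[ x ∈ vecs (suc k) ] Vᴱ.δᶜ 0ᵐ x (q ^ k * #partners x j)
      ≡⟨ cong (q ^ (k + suc k) * 𝟙 (0 ≡ᵇ j) +_) (∑-δᶜ-scaled-#partners (q ^ k) (suc k) j) ⟩
    splitCoeff q k j (#weight (suc k + suc k) j) (#weight (suc k) j) ∎
    where
    0ᵐ = zeros (suc k)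
    resp : (λ x → #params-of-weight x j) Preserves _≋_ ⟶ _≡_
    resp x≋x′ = ∑-cong (λ p → cong₂ (λ a b → 𝟙 (a + b ≡ᵇ j))
                                    (wt-cong x≋x′) (wt-cong (·T-congˡ p x≋x′))) (allParams k)

theorem3p3 : ∀ {c ℓ : Level} (F : FiniteField c ℓ) (q : ℕ) → IsPrimePower q →
    FiniteField.order F ≡ q →
    (k : ℕ) → (j : ℕ) → Coding.Ψcoeff F k j ≡ closedCoeff q (suc k) j
theorem3p3 F q _ refl k j = begin
  Coding.Ψcoeff F k j
    ≡⟨ Ψcoeff-formula F k j ⟩
  splitCoeff q k j (#weight F (m + m) j) (#weight F m j)
    ≡⟨ cong₂ (splitCoeff q k j) (#weight≡ F (m + m) j) (#weight≡ F m j) ⟩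
  splitCoeff q k j (((m + m) C j) * (q ∸ 1) ^ j) ((m C j) * (q ∸ 1) ^ j)
    ≡⟨ closedCoeff≡ q k j ⟩
  closedCoeff q m j ∎
  where m = suc k
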